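{- Let $d,n$ be positive integers and $0\le k\le n$ an integer. Then $$\left\langle \begin{matrix} n\\ k\end{matrix}\right\rangle_d=\det\left(\binom{n+d+j-i-1}{n-1}\right)_{i,j=0}^{k-1}.$$
   Context: For a positive integer $d$ and integer $m\ge0$, $\langle m\rangle_d=\binom{m+d-1}{d}$. For $0\le k\le n$, $\left\langle \begin{matrix} n\\ k\end{matrix}\right\rangle_d=\prod_{j=0}^{k-1}\frac{\langle n-j\rangle_d}{\langle k-j\rangle_d}$. A $0\times0$ determinant equals $1$; $\binom{a}{m}=0$ if $m>a$. -}

module Defs where

open import Data.Nat using (ℕ; zero; suc; _+_; _∸_)
open import Data.Nat.Combinatorics using (_C_)
open import Data.Fin using (Fin; zero; suc; toℕ; punchIn)
open import Data.Integer using (ℤ; +_; -_)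
import Data.Integer as ℤ
open import Data.Rational using (ℚ; 0ℚ; 1ℚ)
import Data.Rational as ℚ

-- ⟨ m ⟩_d = binom (m + d - 1) d   (d ≥ 1 in all uses, so m + d - 1 ≥ 0)
⟨_⟩_ : ℕ → ℕ → ℕ
⟨ m ⟩ d = (m + d ∸ 1) C d

-- a / b as a rational number of naturals (b = 0 never occurs in our uses;
-- junk value 0 in that case)
_/ℕ_ : ℕ → ℕ → ℚ
a /ℕ zero = 0ℚ
a /ℕ suc b = (+ a) ℚ./ suc b

∏ℚ : ℕ → (ℕ → ℚ) → ℚ
∏ℚ zero f = 1ℚ
∏ℚ (suc k) f = ∏ℚ k f ℚ.* f k

dnomial : ℕ → ℕ → ℕ → ℚ
dnomial d n k = ∏ℚ k (λ j → (⟨ n ∸ j ⟩ d) /ℕ (⟨ k ∸ j ⟩ d))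

Σℤ : ∀ n → (Fin n → ℤ) → ℤ
Σℤ zero f = + 0
Σℤ (suc n) f = f zero ℤ.+ Σℤ n (λ i → f (suc i))

sgn : ℕ → ℤ
sgn zero = + 1
sgn (suc i) = - sgn i

det : ∀ n → (Fin n → Fin n → ℤ) → ℤ
det zero M = + 1
det (suc n) M =
  Σℤ (suc n) (λ j → sgn (toℕ j) ℤ.* M zero j ℤ.* det n (λ r c → M (suc r) (punchIn j c)))

binomMatrix : ℕ → ℕ → ∀ k → Fin k → Fin k → ℤ
binomMatrix d n k i j = + ((n + d + toℕ j ∸ (toℕ i + 1)) C (n ∸ 1))

-- Both sides satisfy the same recursion in (n, k) with the same initial value 1 at k = 0.
-- For the d-nomial this is  ⟨n;k⟩ = (⟨n⟩/⟨k⟩)·⟨n−1;k−1⟩.  For the determinant D(n,k) of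
-- A = (binom(n+d+j−i−1, n−1))_{i,j<k}, replace column j (for j = 0, …, k−2, from left to right,
-- so that column j+1 is still original) by (n+d+j)·col_j − (d+j+1)·col_{j+1}.  By Pascal's rule
-- and absorption the new (i, j) entry is −i·binom(n+d+j−i−1, n−2), so the first row vanishes
-- except in the last column, where it is binom(n+d+k−2, n−1).  Expanding along the first row and
-- pulling −i out of row i leaves the matrix for (n−1, k−1):
--   (n+d)(n+d+1)⋯(n+d+k−2) · D(n,k) = binom(n+d+k−2, n−1) · (k−1)! · D(n−1,k−1),
-- and an identity between binomial coefficients turns this into ⟨k⟩·D(n,k) = ⟨n⟩·D(n−1,k−1).

module Submission where

open import Defs
open import Data.Nat using (ℕ; _≤_; _≥_)
open import Data.Rational using (ℚ)
import Data.Rational as ℚ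
open import Relation.Binary.PropositionalEquality using (_≡_)

module Binomial where

  open import Data.Nat
  open import Data.Nat.Properties
  open import Data.Nat.Combinatorics using (_C_; nCk+nC[k+1]≡[n+1]C[k+1]; nCk≡nC[n∸k]; nCn≡1; nC1≡n)
  open import Data.Nat.Tactic.RingSolver using (solve-∀; solve)
  open import Data.List using (_∷_; [])
  open import Relation.Binary.PropositionalEquality
  open ≡-Reasoning

  0<nCk : ∀ {n k} → k ≤ n → 0 < n C k
  0<nCk {k = zero} _ = s≤s z≤n
  0<nCk {suc n} {suc k} (s≤s k≤n) =
    subst (0 <_) (nCk+nC[k+1]≡[n+1]C[k+1] n k) (<-≤-trans (0<nCk k≤n) (m≤m+n _ _))

  [1+k]*[1+n]C[1+k]≡[1+n]*nCk : ∀ n k → suc k * (suc n C suc k) ≡ suc n * (n C k)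
  [1+k]*[1+n]C[1+k]≡[1+n]*nCk zero zero = refl
  [1+k]*[1+n]C[1+k]≡[1+n]*nCk zero (suc k) = *-zeroʳ (suc (suc k))
  [1+k]*[1+n]C[1+k]≡[1+n]*nCk (suc n) zero =
    trans (+-identityʳ _) (trans (nC1≡n (suc (suc n))) (sym (*-identityʳ _)))
  [1+k]*[1+n]C[1+k]≡[1+n]*nCk (suc n) (suc k) = begin
      suc (suc k) * (suc (suc n) C suc (suc k))
    ≡⟨ cong (suc (suc k) *_) (sym (nCk+nC[k+1]≡[n+1]C[k+1] (suc n) (suc k))) ⟩
      suc (suc k) * (u + v)
    ≡⟨ distribute k u v ⟩
      u + (suc k * u + suc (suc k) * v)
    ≡⟨ cong (u +_) (cong₂ _+_ ([1+k]*[1+n]C[1+k]≡[1+n]*nCk n k) ([1+k]*[1+n]C[1+k]≡[1+n]*nCk n (suc k))) ⟩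
      u + (suc n * (n C k) + suc n * (n C suc k))
    ≡⟨ cong (u +_) (sym (*-distribˡ-+ (suc n) (n C k) (n C suc k))) ⟩
      u + suc n * (n C k + n C suc k)
    ≡⟨ cong (λ x → u + suc n * x) (nCk+nC[k+1]≡[n+1]C[k+1] n k) ⟩
      suc (suc n) * u
    ∎
    where
    u = suc n C suc k
    v = suc n C suc (suc k)
    distribute : ∀ k u v → suc (suc k) * (u + v) ≡ u + (suc k * u + suc (suc k) * v)
    distribute = solve-∀

  [r+s]Cr≡[r+s]Cs : ∀ r s → (r + s) C r ≡ (r + s) C s
  [r+s]Cr≡[r+s]Cs r s = trans (nCk≡nC[n∸k] (m≤m+n r s)) (cong ((r + s) C_) (m+n∸m≡n r s))

  [1+s]*[1+x]Cr≡[1+x]*xCr : ∀ r s x → r + s ≡ x → suc s * (suc x C r) ≡ suc x * (x C r)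
  [1+s]*[1+x]Cr≡[1+x]*xCr r s x refl = begin
      suc s * (suc (r + s) C r)
    ≡⟨ cong (λ y → suc s * (y C r)) (sym (+-suc r s)) ⟩
      suc s * ((r + suc s) C r)
    ≡⟨ cong (suc s *_) ([r+s]Cr≡[r+s]Cs r (suc s)) ⟩
      suc s * ((r + suc s) C suc s)
    ≡⟨ cong (λ y → suc s * (y C suc s)) (+-suc r s) ⟩
      suc s * (suc (r + s) C suc s)
    ≡⟨ [1+k]*[1+n]C[1+k]≡[1+n]*nCk (r + s) s ⟩
      suc (r + s) * ((r + s) C s)
    ≡⟨ cong (suc (r + s) *_) ([r+s]Cr≡[r+s]Cs r s) ⟨
      suc (r + s) * ((r + s) C r)
    ∎

  rising : ℕ → ℕ → ℕ
  rising x zero = 1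
  rising x (suc k) = rising x k * suc (x + k)

  rising-nonZero : ∀ x k → NonZero (rising x k)
  rising-nonZero x zero = _
  rising-nonZero x (suc k) = m*n≢0 (rising x k) (suc (x + k)) {{rising-nonZero x k}}

  [n+d]Cd*rising≡[K+d]Cd*[n+d+K]Cn*K! : ∀ n d K →
    ((n + d) C d) * rising (n + d) K ≡ ((K + d) C d) * (((n + d + K) C n) * K !)
  [n+d]Cd*rising≡[K+d]Cd*[n+d+K]Cn*K! n d zero = begin
      ((n + d) C d) * 1                  ≡⟨ *-identityʳ _ ⟩
      (n + d) C d                        ≡⟨ [r+s]Cr≡[r+s]Cs n d ⟨
      (n + d) C n                        ≡⟨ trans (cong₂ (λ a b → a * ((b C n) * 1)) (nCn≡1 d) (+-identityʳ (n + d)))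
                                                  (trans (*-identityˡ _) (*-identityʳ _)) ⟨
      (d C d) * (((n + d + 0) C n) * 1)  ∎
  [n+d]Cd*rising≡[K+d]Cd*[n+d+K]Cn*K! n d (suc K) = begin
      ((n + d) C d) * (rising (n + d) K * suc (n + d + K))
    ≡⟨ *-assoc ((n + d) C d) _ _ ⟨
      ((n + d) C d) * rising (n + d) K * suc (n + d + K)
    ≡⟨ cong (_* suc (n + d + K)) ([n+d]Cd*rising≡[K+d]Cd*[n+d+K]Cn*K! n d K) ⟩
      ((K + d) C d) * (((n + d + K) C n) * K !) * suc (n + d + K)
    ≡⟨ exchange ((K + d) C d) ((suc K + d) C d) ((n + d + K) C n) ((n + d + suc K) C n)
                (K !) (suc K) (suc (K + d)) (suc (n + d + K))
         ([1+s]*[1+x]Cr≡[1+x]*xCr d K (K + d) (+-comm d K))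
         (trans (cong (λ x → suc (K + d) * (x C n)) (+-suc (n + d) K))
                ([1+s]*[1+x]Cr≡[1+x]*xCr n (K + d) (n + d + K) (trans (cong (n +_) (+-comm K d)) (sym (+-assoc n d K))))) ⟩
      ((suc K + d) C d) * (((n + d + suc K) C n) * (suc K * K !))
    ∎
    where
    exchange : ∀ c c′ q q′ f k e y → k * c′ ≡ e * c → e * q′ ≡ y * q →
               c * (q * f) * y ≡ c′ * (q′ * (k * f))
    exchange c c′ q q′ f k e y kc′≡ec eq′≡yq = begin
      c * (q * f) * y    ≡⟨ solve (c ∷ q ∷ f ∷ y ∷ []) ⟩
      c * f * (y * q)    ≡⟨ cong (c * f *_) eq′≡yq ⟨
      c * f * (e * q′)   ≡⟨ solve (c ∷ f ∷ e ∷ q′ ∷ []) ⟩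
      e * c * f * q′     ≡⟨ cong (λ x → x * f * q′) kc′≡ec ⟨
      k * c′ * f * q′    ≡⟨ solve (k ∷ c′ ∷ f ∷ q′ ∷ []) ⟩
      c′ * (q′ * (k * f)) ∎

  column-combination-identity : ∀ m D Y i c₀ c₁ →
    Y + (i + 1) ≡ suc (suc m) + D → suc m * (c₀ + c₁) ≡ suc Y * c₀ →
    suc D * (c₀ + c₁) ≡ (suc (suc m) + D) * c₁ + i * c₀
  column-combination-identity m D Y i c₀ c₁ Y+i+1≡ absorb = +-cancelʳ-≡ (suc Y * c₀) _ _ (begin
      suc D * (c₀ + c₁) + suc Y * c₀                    ≡⟨ cong (suc D * (c₀ + c₁) +_) absorb ⟨
      suc D * (c₀ + c₁) + suc m * (c₀ + c₁)            ≡⟨ solve (m ∷ D ∷ c₀ ∷ c₁ ∷ []) ⟩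
      (suc (suc m) + D) * c₁ + (suc (suc m) + D) * c₀  ≡⟨ cong (λ x → (suc (suc m) + D) * c₁ + x * c₀) Y+i+1≡ ⟨
      (suc (suc m) + D) * c₁ + (Y + (i + 1)) * c₀      ≡⟨ solve (m ∷ D ∷ Y ∷ i ∷ c₀ ∷ c₁ ∷ []) ⟩
      (suc (suc m) + D) * c₁ + i * c₀ + suc Y * c₀      ∎)

  binomEntry : ℕ → ℕ → ℕ → ℕ → ℕ
  binomEntry d n i j = (n + d + j ∸ (i + 1)) C (n ∸ 1)

  binomEntry-column-combination : ∀ d m i j → i ≤ suc m →
    suc (d + j) * binomEntry d (suc (suc m)) i (suc j)
      ≡ (suc (suc m) + d + j) * binomEntry d (suc (suc m)) i j + i * ((suc (suc m) + d + j ∸ (i + 1)) C m)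
  binomEntry-column-combination d m i j i≤1+m = begin
      suc (d + j) * ((n + d + suc j ∸ (i + 1)) C suc m)
    ≡⟨ cong (λ y → suc (d + j) * (y C suc m)) X′∸[i+1]≡1+Y ⟩
      suc (d + j) * (suc Y C suc m)
    ≡⟨ cong (suc (d + j) *_) (nCk+nC[k+1]≡[n+1]C[k+1] Y m) ⟨
      suc (d + j) * (Y C m + Y C suc m)
    ≡⟨ column-combination-identity m (d + j) Y i (Y C m) (Y C suc m) Y+[i+1]≡ absorb ⟩
      (n + (d + j)) * (Y C suc m) + i * (Y C m)
    ≡⟨ cong (λ x → x * (Y C suc m) + i * (Y C m)) (+-assoc n d j) ⟨
      (n + d + j) * (Y C suc m) + i * (Y C m)
    ∎
    where
    n = suc (suc m)
    X = n + d + j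
    Y = X ∸ (i + 1)
    i+1≤X : i + 1 ≤ X
    i+1≤X = ≤-trans (subst (_≤ n) (+-comm 1 i) (s≤s i≤1+m)) (≤-trans (m≤m+n n d) (m≤m+n (n + d) j))
    X′∸[i+1]≡1+Y : n + d + suc j ∸ (i + 1) ≡ suc Y
    X′∸[i+1]≡1+Y = trans (cong (_∸ (i + 1)) (+-suc (n + d) j)) (+-∸-assoc 1 i+1≤X)
    Y+[i+1]≡ : Y + (i + 1) ≡ n + (d + j)
    Y+[i+1]≡ = trans (m∸n+n≡m i+1≤X) (+-assoc n d j)
    absorb : suc m * (Y C m + Y C suc m) ≡ suc Y * (Y C m)
    absorb = trans (cong (suc m *_) (nCk+nC[k+1]≡[n+1]C[k+1] Y m)) ([1+k]*[1+n]C[1+k]≡[1+n]*nCk Y m)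

module Determinant where

  open import Data.Nat using (ℕ; zero; suc; _≤_; _<_; s≤s; _<?_)
  import Data.Nat.Properties as ℕP
  open import Data.Fin using (Fin; zero; suc; toℕ; punchIn; punchOut; fromℕ; fromℕ<; inject₁; lower₁; _≟_)
  import Data.Fin.Properties as FinP
  open import Data.Integer using (ℤ; +_; -_; _+_; _*_)
  import Data.Integer.Properties as ℤP
  open import Data.Integer.Tactic.RingSolver using (solve-∀)
  open import Data.Product using (∃₂; _×_; _,_)
  open import Data.Sum using (_⊎_; inj₁; inj₂)
  open import Function using (_∘_)
  open import Relation.Nullary using (¬_; yes; no; contradiction)
  open import Relation.Binary.Definitions using (tri<; tri≈; tri>)
  open import Relation.Binary.PropositionalEquality
  open ≡-Reasoning

  Σℤ-cong : ∀ n {f g : Fin n → ℤ} → (∀ i → f i ≡ g i) → Σℤ n f ≡ Σℤ n g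
  Σℤ-cong zero f≡g = refl
  Σℤ-cong (suc n) f≡g = cong₂ _+_ (f≡g zero) (Σℤ-cong n (f≡g ∘ suc))

  Σℤ-scale : ∀ n a (f : Fin n → ℤ) → Σℤ n (λ i → a * f i) ≡ a * Σℤ n f
  Σℤ-scale zero a f = sym (ℤP.*-zeroʳ a)
  Σℤ-scale (suc n) a f =
    trans (cong (_+_ (a * f zero)) (Σℤ-scale n a (f ∘ suc))) (sym (ℤP.*-distribˡ-+ a _ _))

  Σℤ-+ : ∀ n (f g : Fin n → ℤ) → Σℤ n (λ i → f i + g i) ≡ Σℤ n f + Σℤ n g
  Σℤ-+ zero f g = refl
  Σℤ-+ (suc n) f g =
    trans (cong (_+_ (f zero + g zero)) (Σℤ-+ n (f ∘ suc) (g ∘ suc)))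
          (interchange (f zero) (g zero) (Σℤ n (f ∘ suc)) (Σℤ n (g ∘ suc)))
    where
    interchange : ∀ a b c d → a + b + (c + d) ≡ a + c + (b + d)
    interchange = solve-∀

  Σℤ-linear : ∀ n a b (f g : Fin n → ℤ) → Σℤ n (λ i → a * f i + b * g i) ≡ a * Σℤ n f + b * Σℤ n g
  Σℤ-linear n a b f g = trans (Σℤ-+ n _ _) (cong₂ _+_ (Σℤ-scale n a f) (Σℤ-scale n b g))

  Σℤ-zero : ∀ n (f : Fin n → ℤ) → (∀ i → f i ≡ + 0) → Σℤ n f ≡ + 0
  Σℤ-zero zero f f≡0 = refl
  Σℤ-zero (suc n) f f≡0 = cong₂ _+_ (f≡0 zero) (Σℤ-zero n (f ∘ suc) (f≡0 ∘ suc))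

  Σℤ-single : ∀ n (f : Fin n → ℤ) c → (∀ j → j ≢ c → f j ≡ + 0) → Σℤ n f ≡ f c
  Σℤ-single (suc n) f zero f≡0 =
    trans (cong (_+_ (f zero)) (Σℤ-zero n (f ∘ suc) (λ j → f≡0 (suc j) λ ()))) (ℤP.+-identityʳ _)
  Σℤ-single (suc n) f (suc c) f≡0 =
    trans (cong (_+ Σℤ n (f ∘ suc)) (f≡0 zero λ ()))
          (trans (ℤP.+-identityˡ _) (Σℤ-single n (f ∘ suc) c λ j j≢c → f≡0 (suc j) (j≢c ∘ FinP.suc-injective)))

  Σℤ-pair : ∀ n (f : Fin n → ℤ) c c′ → c ≢ c′ → (∀ j → j ≢ c → j ≢ c′ → f j ≡ + 0) →
    Σℤ n f ≡ f c + f c′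
  Σℤ-pair (suc n) f zero zero c≢c′ _ = contradiction refl c≢c′
  Σℤ-pair (suc n) f zero (suc c′) _ f≡0 =
    cong (_+_ (f zero)) (Σℤ-single n (f ∘ suc) c′ λ j j≢c′ → f≡0 (suc j) (λ ()) (j≢c′ ∘ FinP.suc-injective))
  Σℤ-pair (suc n) f (suc c) zero _ f≡0 =
    trans (cong (_+_ (f zero)) (Σℤ-single n (f ∘ suc) c λ j j≢c → f≡0 (suc j) (j≢c ∘ FinP.suc-injective) (λ ())))
          (ℤP.+-comm (f zero) (f (suc c)))
  Σℤ-pair (suc n) f (suc c) (suc c′) c≢c′ f≡0 =
    trans (cong (_+ Σℤ n (f ∘ suc)) (f≡0 zero (λ ()) (λ ())))
          (trans (ℤP.+-identityˡ _) (Σℤ-pair n (f ∘ suc) c c′ (c≢c′ ∘ cong suc)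
             λ j j≢c j≢c′ → f≡0 (suc j) (j≢c ∘ FinP.suc-injective) (j≢c′ ∘ FinP.suc-injective)))

  Matrix : ℕ → Set
  Matrix n = Fin n → Fin n → ℤ

  minor : ∀ {n} → Matrix (suc n) → Fin (suc n) → Matrix n
  minor M j r c = M (suc r) (punchIn j c)

  laplaceTerm : ∀ {n} → Matrix (suc n) → Fin (suc n) → ℤ
  laplaceTerm {n} M j = sgn (toℕ j) * M zero j * det n (minor M j)

  det-cong : ∀ n {M N : Matrix n} → (∀ i j → M i j ≡ N i j) → det n M ≡ det n N
  det-cong zero _ = refl
  det-cong (suc n) M≡N = Σℤ-cong (suc n) λ j →
    cong₂ (λ x y → sgn (toℕ j) * x * y) (M≡N zero j) (det-cong n λ r c → M≡N (suc r) (punchIn j c))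

  det-linear-column : ∀ n (M M₁ M₂ : Matrix n) (c : Fin n) a b →
    (∀ i j → j ≢ c → M i j ≡ M₁ i j) → (∀ i j → j ≢ c → M i j ≡ M₂ i j) →
    (∀ i → M i c ≡ a * M₁ i c + b * M₂ i c) → det n M ≡ a * det n M₁ + b * det n M₂
  det-linear-column (suc n) M M₁ M₂ c a b M≡M₁ M≡M₂ Mc≡ =
    trans (Σℤ-cong (suc n) laplaceTerm-linear) (Σℤ-linear (suc n) a b (laplaceTerm M₁) (laplaceTerm M₂))
    where
    laplaceTerm-linear : ∀ j → laplaceTerm M j ≡ a * laplaceTerm M₁ j + b * laplaceTerm M₂ j
    laplaceTerm-linear j with j ≟ c
    ... | yes refl = begin
        sgn (toℕ j) * M zero j * det n (minor M j)
      ≡⟨ cong (λ x → sgn (toℕ j) * x * det n (minor M j)) (Mc≡ zero) ⟩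
        sgn (toℕ j) * (a * M₁ zero j + b * M₂ zero j) * det n (minor M j)
      ≡⟨ distribute a b (sgn (toℕ j)) (M₁ zero j) (M₂ zero j) (det n (minor M j)) ⟩
        a * (sgn (toℕ j) * M₁ zero j * det n (minor M j)) + b * (sgn (toℕ j) * M₂ zero j * det n (minor M j))
      ≡⟨ cong₂ (λ D₁ D₂ → a * (sgn (toℕ j) * M₁ zero j * D₁) + b * (sgn (toℕ j) * M₂ zero j * D₂))
               (det-cong n λ r x → M≡M₁ (suc r) (punchIn j x) (FinP.punchInᵢ≢i j x))
               (det-cong n λ r x → M≡M₂ (suc r) (punchIn j x) (FinP.punchInᵢ≢i j x)) ⟩
        a * laplaceTerm M₁ j + b * laplaceTerm M₂ j
      ∎
      where
      distribute : ∀ a b s x y D → s * (a * x + b * y) * D ≡ a * (s * x * D) + b * (s * y * D)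
      distribute = solve-∀
    ... | no j≢c = begin
        sgn (toℕ j) * M zero j * det n (minor M j)
      ≡⟨ cong (_*_ (sgn (toℕ j) * M zero j)) minor-linear ⟩
        sgn (toℕ j) * M zero j * (a * det n (minor M₁ j) + b * det n (minor M₂ j))
      ≡⟨ distribute a b (sgn (toℕ j)) (M zero j) (det n (minor M₁ j)) (det n (minor M₂ j)) ⟩
        a * (sgn (toℕ j) * M zero j * det n (minor M₁ j)) + b * (sgn (toℕ j) * M zero j * det n (minor M₂ j))
      ≡⟨ cong₂ (λ x y → a * (sgn (toℕ j) * x * det n (minor M₁ j)) + b * (sgn (toℕ j) * y * det n (minor M₂ j)))
               (M≡M₁ zero j j≢c) (M≡M₂ zero j j≢c) ⟩
        a * laplaceTerm M₁ j + b * laplaceTerm M₂ j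
      ∎
      where
      distribute : ∀ a b s m D₁ D₂ → s * m * (a * D₁ + b * D₂) ≡ a * (s * m * D₁) + b * (s * m * D₂)
      distribute = solve-∀
      c′ = punchOut j≢c
      punchIn-c′ : punchIn j c′ ≡ c
      punchIn-c′ = FinP.punchIn-punchOut j≢c
      avoids-c : ∀ x → x ≢ c′ → punchIn j x ≢ c
      avoids-c x x≢c′ eq = x≢c′ (FinP.punchIn-injective j x c′ (trans eq (sym punchIn-c′)))
      minor-linear : det n (minor M j) ≡ a * det n (minor M₁ j) + b * det n (minor M₂ j)
      minor-linear = det-linear-column n (minor M j) (minor M₁ j) (minor M₂ j) c′ a b
        (λ r x x≢c′ → M≡M₁ (suc r) (punchIn j x) (avoids-c x x≢c′))
        (λ r x x≢c′ → M≡M₂ (suc r) (punchIn j x) (avoids-c x x≢c′))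
        (λ r → subst (λ y → M (suc r) y ≡ a * M₁ (suc r) y + b * M₂ (suc r) y) (sym punchIn-c′) (Mc≡ (suc r)))

  punchIn-adjacent : ∀ {m} (c c′ : Fin (suc m)) → toℕ c′ ≡ suc (toℕ c) → ∀ x →
    punchIn c x ≡ punchIn c′ x ⊎ (punchIn c x ≡ c′ × punchIn c′ x ≡ c)
  punchIn-adjacent zero (suc zero) _ zero = inj₂ (refl , refl)
  punchIn-adjacent zero (suc zero) _ (suc x) = inj₁ refl
  punchIn-adjacent (suc c) (suc c′) _ zero = inj₁ refl
  punchIn-adjacent (suc c) (suc c′) c′≡1+c (suc x) with punchIn-adjacent c c′ (ℕP.suc-injective c′≡1+c) x
  ... | inj₁ eq = inj₁ (cong suc eq)
  ... | inj₂ (eq , eq′) = inj₂ (cong suc eq , cong suc eq′)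

  punchIn-adjacent-preimage : ∀ {m} (j c c′ : Fin (suc m)) → toℕ c′ ≡ suc (toℕ c) → j ≢ c → j ≢ c′ →
    ∃₂ λ a b → punchIn j a ≡ c × punchIn j b ≡ c′ × toℕ b ≡ suc (toℕ a)
  punchIn-adjacent-preimage zero zero _ _ j≢c _ = contradiction refl j≢c
  punchIn-adjacent-preimage zero (suc a) (suc b) b≡1+a _ _ = a , b , refl , refl , ℕP.suc-injective b≡1+a
  punchIn-adjacent-preimage {suc m} (suc zero) zero (suc zero) _ _ j≢c′ = contradiction refl j≢c′
  punchIn-adjacent-preimage {suc (suc m)} (suc (suc j)) zero (suc zero) _ _ _ = zero , suc zero , refl , refl , refl
  punchIn-adjacent-preimage {suc m} (suc j) (suc c) (suc c′) c′≡1+c j≢c j≢c′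
    with punchIn-adjacent-preimage j c c′ (ℕP.suc-injective c′≡1+c) (j≢c ∘ cong suc) (j≢c′ ∘ cong suc)
  ... | a , b , a↦c , b↦c′ , b≡1+a = suc a , suc b , cong suc a↦c , cong suc b↦c′ , cong suc b≡1+a

  adjacent⇒≢ : ∀ {n} {c c′ : Fin n} → toℕ c′ ≡ suc (toℕ c) → c ≢ c′
  adjacent⇒≢ c′≡1+c c≡c′ = ℕP.1+n≢n (sym (trans (cong toℕ c≡c′) c′≡1+c))

  -- Deleting a column other than c, c′ keeps them adjacent and equal in the minor; the terms for
  -- c and c′ have the same minor and opposite signs.
  det-adjacent-equal-columns : ∀ n (M : Matrix n) (c c′ : Fin n) → toℕ c′ ≡ suc (toℕ c) →
    (∀ i → M i c ≡ M i c′) → det n M ≡ + 0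
  det-adjacent-equal-columns (suc zero) M zero zero () _
  det-adjacent-equal-columns (suc (suc n)) M c c′ c′≡1+c Mc≡Mc′ =
    trans (Σℤ-pair (suc (suc n)) (laplaceTerm M) c c′ (adjacent⇒≢ c′≡1+c) λ j j≢c j≢c′ →
             let a , b , a↦c , b↦c′ , b≡1+a = punchIn-adjacent-preimage j c c′ c′≡1+c j≢c j≢c′ in
             trans (cong (_*_ (sgn (toℕ j) * M zero j))
                         (det-adjacent-equal-columns (suc n) (minor M j) a b b≡1+a λ r →
                            trans (cong (M (suc r)) a↦c) (trans (Mc≡Mc′ (suc r)) (cong (M (suc r)) (sym b↦c′)))))
                   (ℤP.*-zeroʳ (sgn (toℕ j) * M zero j)))
          adjacent-terms-cancel
    where
    same-minor : ∀ r x → minor M c′ r x ≡ minor M c r x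
    same-minor r x with punchIn-adjacent c c′ c′≡1+c x
    ... | inj₁ eq = cong (M (suc r)) (sym eq)
    ... | inj₂ (c↦c′ , c′↦c) =
      trans (cong (M (suc r)) c′↦c) (trans (Mc≡Mc′ (suc r)) (cong (M (suc r)) (sym c↦c′)))
    adjacent-terms-cancel : laplaceTerm M c + laplaceTerm M c′ ≡ + 0
    adjacent-terms-cancel
      rewrite c′≡1+c | sym (Mc≡Mc′ zero) | det-cong (suc n) same-minor =
      cancel (sgn (toℕ c)) (M zero c) (det (suc n) (minor M c))
      where
      cancel : ∀ s m D → s * m * D + - s * m * D ≡ + 0
      cancel = solve-∀

  overwrite-column : ∀ {n} → Matrix n → Fin n → Fin n → Matrix n
  overwrite-column M c c′ i j with j ≟ c
  ... | yes _ = M i c′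
  ... | no _ = M i j

  overwrite-column-at : ∀ {n} (M : Matrix n) c c′ i → overwrite-column M c c′ i c ≡ M i c′
  overwrite-column-at M c c′ i with c ≟ c
  ... | yes _ = refl
  ... | no c≢c = contradiction refl c≢c

  overwrite-column-off : ∀ {n} (M : Matrix n) c c′ i j → j ≢ c → overwrite-column M c c′ i j ≡ M i j
  overwrite-column-off M c c′ i j j≢c with j ≟ c
  ... | yes j≡c = contradiction j≡c j≢c
  ... | no _ = refl

  det-add-adjacent-column : ∀ n (M N : Matrix n) (c c′ : Fin n) a b → toℕ c′ ≡ suc (toℕ c) →
    (∀ i j → j ≢ c → N i j ≡ M i j) → (∀ i → N i c ≡ a * M i c + b * M i c′) → det n N ≡ a * det n M
  det-add-adjacent-column n M N c c′ a b c′≡1+c N≡M Nc≡ = begin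
      det n N
    ≡⟨ det-linear-column n N M M′ c a b N≡M
         (λ i j j≢c → trans (N≡M i j j≢c) (sym (overwrite-column-off M c c′ i j j≢c)))
         (λ i → trans (Nc≡ i) (cong (λ x → a * M i c + b * x) (sym (overwrite-column-at M c c′ i)))) ⟩
      a * det n M + b * det n M′
    ≡⟨ cong (λ x → a * det n M + b * x) (det-adjacent-equal-columns n M′ c c′ c′≡1+c λ i →
         trans (overwrite-column-at M c c′ i)
               (sym (overwrite-column-off M c c′ i c′ (≢-sym (adjacent⇒≢ c′≡1+c))))) ⟩
      a * det n M + b * + 0
    ≡⟨ cong (_+_ (a * det n M)) (ℤP.*-zeroʳ b) ⟩
      a * det n M + + 0
    ≡⟨ ℤP.+-identityʳ _ ⟩
      a * det n M
    ∎
    where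
    M′ = overwrite-column M c c′

  ∏ℤ : ℕ → (ℕ → ℤ) → ℤ
  ∏ℤ zero f = + 1
  ∏ℤ (suc k) f = ∏ℤ k f * f k

  ∏ℤ-shift : ∀ k (f : ℕ → ℤ) → ∏ℤ (suc k) f ≡ f 0 * ∏ℤ k (f ∘ suc)
  ∏ℤ-shift zero f = ℤP.*-comm (+ 1) (f 0)
  ∏ℤ-shift (suc k) f = trans (cong (_* f (suc k)) (∏ℤ-shift k f)) (ℤP.*-assoc (f 0) _ _)

  det-scale-rows : ∀ n (g : ℕ → ℤ) (M : Matrix n) → det n (λ i j → g (toℕ i) * M i j) ≡ ∏ℤ n g * det n M
  det-scale-rows zero g M = refl
  det-scale-rows (suc n) g M = begin
      Σℤ (suc n) (λ j → sgn (toℕ j) * (g 0 * M zero j) * det n (λ r c → g (suc (toℕ r)) * minor M j r c))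
    ≡⟨ Σℤ-cong (suc n) (λ j → cong (_*_ (sgn (toℕ j) * (g 0 * M zero j)))
                                   (det-scale-rows n (g ∘ suc) (minor M j))) ⟩
      Σℤ (suc n) (λ j → sgn (toℕ j) * (g 0 * M zero j) * (∏ℤ n (g ∘ suc) * det n (minor M j)))
    ≡⟨ Σℤ-cong (suc n) (λ j → regroup (sgn (toℕ j)) (g 0) (M zero j) (∏ℤ n (g ∘ suc)) (det n (minor M j))) ⟩
      Σℤ (suc n) (λ j → (g 0 * ∏ℤ n (g ∘ suc)) * laplaceTerm M j)
    ≡⟨ Σℤ-scale (suc n) (g 0 * ∏ℤ n (g ∘ suc)) (laplaceTerm M) ⟩
      (g 0 * ∏ℤ n (g ∘ suc)) * det (suc n) M
    ≡⟨ cong (_* det (suc n) M) (∏ℤ-shift n g) ⟨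
      ∏ℤ (suc n) g * det (suc n) M
    ∎
    where
    regroup : ∀ s a m P D → s * (a * m) * (P * D) ≡ (a * P) * (s * m * D)
    regroup = solve-∀

  punchIn-fromℕ : ∀ n (c : Fin n) → punchIn (fromℕ n) c ≡ inject₁ c
  punchIn-fromℕ (suc n) zero = refl
  punchIn-fromℕ (suc n) (suc c) = cong suc (punchIn-fromℕ n c)

  det-expand-first-row-last : ∀ n (M : Matrix (suc n)) → (∀ c → M zero (inject₁ c) ≡ + 0) →
    det (suc n) M ≡ sgn n * M zero (fromℕ n) * det n (λ r c → M (suc r) (inject₁ c))
  det-expand-first-row-last n M row₀≡0 = begin
      Σℤ (suc n) (laplaceTerm M)
    ≡⟨ Σℤ-single (suc n) (laplaceTerm M) (fromℕ n) (λ j j≢last →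
         trans (cong (λ x → sgn (toℕ j) * x * det n (minor M j)) (row₀-off-last j j≢last))
               (cong (_* det n (minor M j)) (ℤP.*-zeroʳ (sgn (toℕ j))))) ⟩
      sgn (toℕ (fromℕ n)) * M zero (fromℕ n) * det n (minor M (fromℕ n))
    ≡⟨ cong₂ (λ k D → sgn k * M zero (fromℕ n) * D) (FinP.toℕ-fromℕ n)
             (det-cong n λ r c → cong (M (suc r)) (punchIn-fromℕ n c)) ⟩
      sgn n * M zero (fromℕ n) * det n (λ r c → M (suc r) (inject₁ c))
    ∎
    where
    row₀-off-last : ∀ j → j ≢ fromℕ n → M zero j ≡ + 0
    row₀-off-last j j≢last = trans (cong (M zero) (sym (FinP.inject₁-lower₁ j n≢j))) (row₀≡0 (lower₁ j n≢j))
      where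
      n≢j : n ≢ toℕ j
      n≢j n≡j = j≢last (FinP.toℕ-injective (trans (sym n≡j) (sym (FinP.toℕ-fromℕ n))))

  toMatrix : ∀ n → (ℕ → ℕ → ℤ) → Matrix n
  toMatrix n A i j = A (toℕ i) (toℕ j)

  sweep : (α β : ℕ → ℤ) → ℕ → (ℕ → ℕ → ℤ) → ℕ → ℕ → ℤ
  sweep α β t A i j with j <? t
  ... | yes _ = α j * A i j + β j * A i (suc j)
  ... | no _ = A i j

  sweep-< : ∀ α β t A i {j} → j < t → sweep α β t A i j ≡ α j * A i j + β j * A i (suc j)
  sweep-< α β t A i {j} j<t with j <? t
  ... | yes _ = refl
  ... | no j≮t = contradiction j<t j≮t

  sweep-≮ : ∀ α β t A i {j} → ¬ j < t → sweep α β t A i j ≡ A i j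
  sweep-≮ α β t A i {j} j≮t with j <? t
  ... | yes j<t = contradiction j<t j≮t
  ... | no _ = refl

  sweep-suc-≢ : ∀ α β t A i {j} → j ≢ t → sweep α β (suc t) A i j ≡ sweep α β t A i j
  sweep-suc-≢ α β t A i {j} j≢t with ℕP.<-cmp j t
  ... | tri< j<t _ _ = trans (sweep-< α β (suc t) A i (ℕP.m<n⇒m<1+n j<t)) (sym (sweep-< α β t A i j<t))
  ... | tri≈ _ j≡t _ = contradiction j≡t j≢t
  ... | tri> _ _ t<j =
    trans (sweep-≮ α β (suc t) A i (ℕP.<⇒≱ t<j ∘ ℕP.≤-pred)) (sym (sweep-≮ α β t A i (ℕP.<-asym t<j)))

  sweep-suc-≡ : ∀ α β t A i →
    sweep α β (suc t) A i t ≡ α t * sweep α β t A i t + β t * sweep α β t A i (suc t)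
  sweep-suc-≡ α β t A i = begin
      sweep α β (suc t) A i t
    ≡⟨ sweep-< α β (suc t) A i (ℕP.n<1+n t) ⟩
      α t * A i t + β t * A i (suc t)
    ≡⟨ cong₂ (λ x y → α t * x + β t * y) (sweep-≮ α β t A i (ℕP.<-irrefl refl))
                                        (sweep-≮ α β t A i (ℕP.<-asym (ℕP.n<1+n t))) ⟨
      α t * sweep α β t A i t + β t * sweep α β t A i (suc t)
    ∎

  det-sweep : ∀ K α β A t → t ≤ K →
    det (suc K) (toMatrix (suc K) (sweep α β t A)) ≡ ∏ℤ t α * det (suc K) (toMatrix (suc K) A)
  det-sweep K α β A zero _ =
    trans (det-cong (suc K) λ i j → sweep-≮ α β 0 A (toℕ i) {toℕ j} λ ()) (sym (ℤP.*-identityˡ _))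
  det-sweep K α β A (suc t) t<K = begin
      det (suc K) (S (suc t))
    ≡⟨ det-add-adjacent-column (suc K) (S t) (S (suc t)) c c′ (α t) (β t) c′≡1+c
         (λ i j j≢c → sweep-suc-≢ α β t A (toℕ i) λ j≡t → j≢c (FinP.toℕ-injective (trans j≡t (sym c≡t))))
         combined-column ⟩
      α t * det (suc K) (S t)
    ≡⟨ cong (_*_ (α t)) (det-sweep K α β A t (ℕP.<⇒≤ t<K)) ⟩
      α t * (∏ℤ t α * det (suc K) (toMatrix (suc K) A))
    ≡⟨ ℤP.*-assoc (α t) _ _ ⟨
      α t * ∏ℤ t α * det (suc K) (toMatrix (suc K) A)
    ≡⟨ cong (_* det (suc K) (toMatrix (suc K) A)) (ℤP.*-comm (α t) (∏ℤ t α)) ⟩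
      ∏ℤ (suc t) α * det (suc K) (toMatrix (suc K) A)
    ∎
    where
    S : ℕ → Matrix (suc K)
    S s = toMatrix (suc K) (sweep α β s A)
    c c′ : Fin (suc K)
    c = fromℕ< (ℕP.m<n⇒m<1+n t<K)
    c′ = fromℕ< (s≤s t<K)
    c≡t : toℕ c ≡ t
    c≡t = FinP.toℕ-fromℕ< (ℕP.m<n⇒m<1+n t<K)
    c′≡1+t : toℕ c′ ≡ suc t
    c′≡1+t = FinP.toℕ-fromℕ< (s≤s t<K)
    c′≡1+c : toℕ c′ ≡ suc (toℕ c)
    c′≡1+c = trans c′≡1+t (cong suc (sym c≡t))
    combined-column : ∀ i → S (suc t) i c ≡ α t * S t i c + β t * S t i c′
    combined-column i =
      subst₂ (λ x y → sweep α β (suc t) A (toℕ i) x ≡ α t * sweep α β t A (toℕ i) x + β t * sweep α β t A (toℕ i) y)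
             (sym c≡t) (sym c′≡1+t) (sweep-suc-≡ α β t A (toℕ i))

module BinomialMatrix where

  open Binomial
  open Determinant
  open import Data.Nat as ℕ using (ℕ; zero; suc; _≤_; z≤n; _!)
  import Data.Nat.Properties as ℕP
  open import Data.Nat.Combinatorics using (_C_)
  open import Data.Fin using (zero; suc; toℕ; fromℕ; inject₁)
  import Data.Fin.Properties as FinP
  open import Data.Integer using (ℤ; +_; -_; _+_; _*_)
  import Data.Integer.Properties as ℤP
  open import Data.Integer.Tactic.RingSolver using (solve-∀)
  open import Relation.Binary.PropositionalEquality
  open ≡-Reasoning

  +x*+a-+y*+b≡-+z : ∀ x a y b z → y ℕ.* b ≡ x ℕ.* a ℕ.+ z → + x * + a + (- + y) * + b ≡ - + z
  +x*+a-+y*+b≡-+z x a y b z yb≡xa+z = begin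
      + x * + a + (- + y) * + b
    ≡⟨ cong₂ _+_ (ℤP.pos-* x a) (ℤP.neg-distribˡ-* (+ y) (+ b)) ⟨
      + (x ℕ.* a) + - (+ y * + b)
    ≡⟨ cong (λ t → + (x ℕ.* a) + - t) (ℤP.pos-* y b) ⟨
      + (x ℕ.* a) + - + (y ℕ.* b)
    ≡⟨ cong (λ t → + (x ℕ.* a) + - t) (trans (cong +_ yb≡xa+z) (ℤP.pos-+ (x ℕ.* a) z)) ⟩
      + (x ℕ.* a) + - (+ (x ℕ.* a) + + z)
    ≡⟨ cancel (+ (x ℕ.* a)) (+ z) ⟩
      - + z
    ∎
    where
    cancel : ∀ p q → p + - (p + q) ≡ - q
    cancel = solve-∀

  sgn-square : ∀ k → sgn k * sgn k ≡ + 1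
  sgn-square zero = refl
  sgn-square (suc k) = trans (neg*neg (sgn k)) (sgn-square k)
    where
    neg*neg : ∀ s → - s * - s ≡ s * s
    neg*neg = solve-∀

  ∏ℤ-neg-suc : ∀ k → ∏ℤ k (λ r → - + suc r) ≡ sgn k * + (k !)
  ∏ℤ-neg-suc zero = refl
  ∏ℤ-neg-suc (suc k) = begin
      ∏ℤ k (λ r → - + suc r) * - + suc k
    ≡⟨ cong (_* - + suc k) (∏ℤ-neg-suc k) ⟩
      sgn k * + (k !) * - + suc k
    ≡⟨ regroup (sgn k) (+ (k !)) (+ suc k) ⟩
      - sgn k * (+ suc k * + (k !))
    ≡⟨ cong (_*_ (- sgn k)) (ℤP.pos-* (suc k) (k !)) ⟨
      - sgn k * + (suc k ℕ.! )
    ∎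
    where
    regroup : ∀ s f x → s * f * - x ≡ - s * (x * f)
    regroup = solve-∀

  ∏ℤ-rising : ∀ x k → ∏ℤ k (λ j → + suc (x ℕ.+ j)) ≡ + rising x k
  ∏ℤ-rising x zero = refl
  ∏ℤ-rising x (suc k) =
    trans (cong (_* + suc (x ℕ.+ k)) (∏ℤ-rising x k)) (sym (ℤP.pos-* (rising x k) (suc (x ℕ.+ k))))

  module _ (d : ℕ) where

    binomEntryℤ : ℕ → ℕ → ℕ → ℤ
    binomEntryℤ n i j = + binomEntry d n i j

    α : ℕ → ℕ → ℤ
    α n j = + (n ℕ.+ d ℕ.+ j)

    β : ℕ → ℤ
    β j = - + suc (d ℕ.+ j)

    binomEntryℤ-column-combination : ∀ m i j → i ≤ suc m →
      α (suc (suc m)) j * binomEntryℤ (suc (suc m)) i j + β j * binomEntryℤ (suc (suc m)) i (suc j)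
        ≡ - (+ i * + ((suc (suc m) ℕ.+ d ℕ.+ j ℕ.∸ (i ℕ.+ 1)) C m))
    binomEntryℤ-column-combination m i j i≤1+m =
      trans (+x*+a-+y*+b≡-+z (suc (suc m) ℕ.+ d ℕ.+ j) (binomEntry d (suc (suc m)) i j)
                              (suc (d ℕ.+ j)) (binomEntry d (suc (suc m)) i (suc j)) (i ℕ.* Cᵢ)
                              (binomEntry-column-combination d m i j i≤1+m))
            (cong -_ (ℤP.pos-* i Cᵢ))
      where
      Cᵢ = (suc (suc m) ℕ.+ d ℕ.+ j ℕ.∸ (i ℕ.+ 1)) C m

    binomMatrix-recurrence : ∀ n K → K ≤ n →
      ∏ℤ K (α (suc n)) * det (suc K) (binomMatrix d (suc n) (suc K))
        ≡ + (((n ℕ.+ d ℕ.+ K) C n) ℕ.* K !) * det K (binomMatrix d n K)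
    binomMatrix-recurrence zero zero _ = refl
    binomMatrix-recurrence (suc m) K K≤1+m = begin
        ∏ℤ K (α n) * det (suc K) (toMatrix (suc K) (binomEntryℤ n))
      ≡⟨ det-sweep K (α n) β (binomEntryℤ n) K ℕP.≤-refl ⟨
        det (suc K) S
      ≡⟨ det-expand-first-row-last K S first-row ⟩
        sgn K * S zero (fromℕ K) * det K (λ r c → S (suc r) (inject₁ c))
      ≡⟨ cong₂ (λ x D → sgn K * x * D) corner (det-cong K lower-rows) ⟩
        sgn K * + c * det K (λ r c → - + suc (toℕ r) * binomMatrix d (suc m) K r c)
      ≡⟨ cong (_*_ (sgn K * + c)) (det-scale-rows K (λ r → - + suc r) (binomMatrix d (suc m) K)) ⟩
        sgn K * + c * (∏ℤ K (λ r → - + suc r) * D)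
      ≡⟨ cong (λ x → sgn K * + c * (x * D)) (∏ℤ-neg-suc K) ⟩
        sgn K * + c * (sgn K * + (K !) * D)
      ≡⟨ regroup (sgn K) (+ c) (+ (K !)) D ⟩
        sgn K * sgn K * (+ c * + (K !) * D)
      ≡⟨ trans (cong (_* (+ c * + (K !) * D)) (sgn-square K)) (ℤP.*-identityˡ _) ⟩
        + c * + (K !) * D
      ≡⟨ cong (_* D) (ℤP.pos-* c (K !)) ⟨
        + (c ℕ.* K !) * D
      ∎
      where
      n = suc (suc m)
      c = (suc m ℕ.+ d ℕ.+ K) C suc m
      D = det K (binomMatrix d (suc m) K)
      S : Matrix (suc K)
      S = toMatrix (suc K) (sweep (α n) β K (binomEntryℤ n))
      first-row : ∀ c → S zero (inject₁ c) ≡ + 0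
      first-row c rewrite FinP.toℕ-inject₁ c =
        trans (sweep-< (α n) β K (binomEntryℤ n) 0 (FinP.toℕ<n c))
              (trans (binomEntryℤ-column-combination m 0 (toℕ c) z≤n)
                     (cong -_ (ℤP.*-zeroˡ (+ ((n ℕ.+ d ℕ.+ toℕ c ℕ.∸ 1) C m)))))
      corner : S zero (fromℕ K) ≡ + c
      corner rewrite FinP.toℕ-fromℕ K = sweep-≮ (α n) β K (binomEntryℤ n) 0 (ℕP.<-irrefl refl)
      lower-rows : ∀ r c → S (suc r) (inject₁ c) ≡ - + suc (toℕ r) * binomMatrix d (suc m) K r c
      lower-rows r c rewrite FinP.toℕ-inject₁ c =
        trans (sweep-< (α n) β K (binomEntryℤ n) (suc (toℕ r)) (FinP.toℕ<n c))
              (trans (binomEntryℤ-column-combination m (suc (toℕ r)) (toℕ c) (ℕP.≤-trans (FinP.toℕ<n r) K≤1+m))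
                     (ℤP.neg-distribˡ-* (+ suc (toℕ r)) _))
      regroup : ∀ s x f D → s * x * (s * f * D) ≡ s * s * (x * f * D)
      regroup = solve-∀

module DnomialRecursion where

  open Binomial
  open Determinant
  open BinomialMatrix
  open import Data.Nat as ℕ using (ℕ; zero; suc; _≤_; s≤s; _!)
  import Data.Nat.Properties as ℕP
  open import Data.Nat.Combinatorics using (_C_)
  open import Data.Integer as ℤ using (ℤ; +_)
  import Data.Integer.Properties as ℤP
  open import Data.Integer.Tactic.RingSolver using (solve)
  import Data.Rational.Properties as ℚP
  open import Data.Rational.Unnormalised as ℚᵘ using (mkℚᵘ; *≡*)
  import Data.Rational.Unnormalised.Properties as ℚᵘP
  open import Data.List using (_∷_; [])
  open import Relation.Nullary using (contradiction)
  open import Relation.Binary.PropositionalEquality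

  *-cross-cancel : ∀ p q a b u v .{{_ : ℤ.NonZero p}} →
    p ℤ.* u ≡ q ℤ.* v → a ℤ.* p ≡ b ℤ.* q → b ℤ.* u ≡ a ℤ.* v
  *-cross-cancel p q a b u v pu≡qv ap≡bq = ℤP.*-cancelˡ-≡ p (b ℤ.* u) (a ℤ.* v) (begin
      p ℤ.* (b ℤ.* u)  ≡⟨ solve (p ∷ b ∷ u ∷ []) ⟩
      b ℤ.* (p ℤ.* u)  ≡⟨ cong (b ℤ.*_) pu≡qv ⟩
      b ℤ.* (q ℤ.* v)  ≡⟨ ℤP.*-assoc b q v ⟨
      b ℤ.* q ℤ.* v    ≡⟨ cong (ℤ._* v) ap≡bq ⟨
      a ℤ.* p ℤ.* v    ≡⟨ solve (a ∷ p ∷ v ∷ []) ⟩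
      p ℤ.* (a ℤ.* v)  ∎)
    where open ≡-Reasoning

  binomMatrix-det-step : ∀ d n K → K ≤ n →
    + ⟨ suc K ⟩ d ℤ.* det (suc K) (binomMatrix d (suc n) (suc K)) ≡ + ⟨ suc n ⟩ d ℤ.* det K (binomMatrix d n K)
  binomMatrix-det-step d n K K≤n =
    *-cross-cancel (+ P) (+ Q) (+ ⟨ suc n ⟩ d) (+ ⟨ suc K ⟩ d) u v {{rising-nonZero (n ℕ.+ d) K}}
      recurrence binomial-identity
    where
    P = rising (n ℕ.+ d) K
    Q = ((n ℕ.+ d ℕ.+ K) C n) ℕ.* K !
    u = det (suc K) (binomMatrix d (suc n) (suc K))
    v = det K (binomMatrix d n K)
    recurrence : + P ℤ.* u ≡ + Q ℤ.* v
    recurrence = trans (cong (ℤ._* u) (sym (∏ℤ-rising (n ℕ.+ d) K))) (binomMatrix-recurrence d n K K≤n)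
    binomial-identity : + ⟨ suc n ⟩ d ℤ.* + P ≡ + ⟨ suc K ⟩ d ℤ.* + Q
    binomial-identity = trans (sym (ℤP.pos-* (⟨ suc n ⟩ d) P))
      (trans (cong +_ ([n+d]Cd*rising≡[K+d]Cd*[n+d+K]Cn*K! n d K)) (ℤP.pos-* (⟨ suc K ⟩ d) Q))

  /ℕ-*-/1 : ∀ a b (u v : ℤ) → b ≢ 0 → + b ℤ.* u ≡ + a ℤ.* v → (a /ℕ b) ℚ.* (v ℚ./ 1) ≡ u ℚ./ 1
  /ℕ-*-/1 a zero u v b≢0 _ = contradiction refl b≢0
  /ℕ-*-/1 a (suc b) u v _ bu≡av = ℚP.toℚᵘ-injective (begin
      ℚ.toℚᵘ ((+ a ℚ./ suc b) ℚ.* (v ℚ./ 1))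
    ≈⟨ ℚP.toℚᵘ-homo-* (+ a ℚ./ suc b) (v ℚ./ 1) ⟩
      ℚ.toℚᵘ (+ a ℚ./ suc b) ℚᵘ.* ℚ.toℚᵘ (v ℚ./ 1)
    ≈⟨ ℚᵘP.*-cong (ℚP.toℚᵘ-fromℚᵘ (mkℚᵘ (+ a) b)) (ℚP.toℚᵘ-fromℚᵘ (mkℚᵘ v 0)) ⟩
      mkℚᵘ (+ a) b ℚᵘ.* mkℚᵘ v 0
    ≈⟨ *≡* cross ⟩
      mkℚᵘ u 0
    ≈⟨ ℚP.toℚᵘ-fromℚᵘ (mkℚᵘ u 0) ⟨
      ℚ.toℚᵘ (u ℚ./ 1)
    ∎)
    where
    open ℚᵘP.≃-Reasoning
    cross : + a ℤ.* v ℤ.* + 1 ≡ u ℤ.* + suc (b ℕ.* 1)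
    cross = trans (ℤP.*-identityʳ _) (trans (sym bu≡av)
              (trans (ℤP.*-comm (+ suc b) u) (cong (λ x → u ℤ.* + suc x) (sym (ℕP.*-identityʳ b)))))

  ∏ℚ-shift : ∀ k (f : ℕ → ℚ) → ∏ℚ (suc k) f ≡ f 0 ℚ.* ∏ℚ k (λ j → f (suc j))
  ∏ℚ-shift zero f = ℚP.*-comm ℚ.1ℚ (f 0)
  ∏ℚ-shift (suc k) f = trans (cong (ℚ._* f (suc k)) (∏ℚ-shift k f)) (ℚP.*-assoc (f 0) _ _)

  dnomial-suc : ∀ d n k → dnomial d (suc n) (suc k) ≡ ((⟨ suc n ⟩ d) /ℕ (⟨ suc k ⟩ d)) ℚ.* dnomial d n k
  dnomial-suc d n k = ∏ℚ-shift k _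

  dnomial≡det : ∀ d n k → k ≤ n → dnomial d n k ≡ det k (binomMatrix d n k) ℚ./ 1
  dnomial≡det d n zero _ = refl
  dnomial≡det d (suc n) (suc k) (s≤s k≤n) = begin
      dnomial d (suc n) (suc k)
    ≡⟨ dnomial-suc d n k ⟩
      ((⟨ suc n ⟩ d) /ℕ (⟨ suc k ⟩ d)) ℚ.* dnomial d n k
    ≡⟨ cong (ℚ._*_ ((⟨ suc n ⟩ d) /ℕ (⟨ suc k ⟩ d))) (dnomial≡det d n k k≤n) ⟩
      ((⟨ suc n ⟩ d) /ℕ (⟨ suc k ⟩ d)) ℚ.* (det k (binomMatrix d n k) ℚ./ 1)
    ≡⟨ /ℕ-*-/1 (⟨ suc n ⟩ d) (⟨ suc k ⟩ d) _ _
               (ℕP.n>0⇒n≢0 (0<nCk (ℕP.m≤n+m d k))) (binomMatrix-det-step d n k k≤n) ⟩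
      det (suc k) (binomMatrix d (suc n) (suc k)) ℚ./ 1
    ∎
    where open ≡-Reasoning

open DnomialRecursion using (dnomial≡det)

theorem6 : (d n k : ℕ) → d ≥ 1 → n ≥ 1 → k ≤ n →
    dnomial d n k ≡ ℚ._/_ (det k (binomMatrix d n k)) 1
theorem6 d n k _ _ k≤n = dnomial≡det d n k k≤n
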